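{- Let $F$ be a clause set. If the reasoning algorithm with inference rules $\mathrm{A1}^+$, $\mathrm{A2}^+$, and A3, started from $\mathcal{S}_0=\{F\}$, yields a complete and clash-free family of clause sets $\mathcal{S}_n$, then $F$ is satisfiable.
   Context: $\mathcal{ALC}$ interpretations $\mathcal{I}=(\Delta^\mathcal{I},\cdot^\mathcal{I})$ with the standard semantics of $\lnot,\sqcap,\sqcup,\forall R.,\exists R.$. Conjunctive normal forms are defined by mutual induction: a concept literal is $A$, $\lnot A$ ($A$ a concept name), $\exists R.F$ or $\forall R.F$ ($R$ a role name, $F$ a conjunctive normal form); a clause is a finite disjunction of concept literals, represented as a set of literals; a conjunctive normal form is a finite conjunction of clauses, represented as a clause set. A clause set denotes the conjunction of its clauses, each clause the disjunction of its literals; $F$ is satisfiable if $F^\mathcal{I}\neq\emptyset$ for some $\mathcal{I}$. The complementary literal $\overline{L}$ is: $\overline{A}=\lnot A$, $\overline{\lnot A}=A$, $\overline{\exists R.F}=\forall R.\mathrm{CNF}(\lnot F)$, $\overline{\forall R.F}=\exists R.\mathrm{CNF}(\lnot F)$, with $\mathrm{CNF}(C)$ the equivalent conjunctive normal form of $C$ (push negations inward, distribute $\sqcup$ over $\sqcap$, flatten). A derivation works on families of clause sets $\mathcal{S}_i$, starting with $\mathcal{S}_0=\{F\}$; $\mathcal{S}_{i+1}$ is obtained from $\mathcal{S}_i$ by applying one of the following rules to a clause set $F\in\mathcal{S}_i$: ($\mathrm{A1}^+$) if $L\in CL$ for a clause $CL\in F$ (nondeterministic choice of $L$): replace every clause $CL'\in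 F$ with $L\in CL'$ by $\{L\}$, and every clause $CL'\in F$ with $\overline{L}\in CL'$ by $CL'\setminus\{\overline{L}\}$. ($\mathrm{A2}^+$) if all clauses of $F$ are unit clauses and $\forall R.F_1\in CL$ for some $CL\in F$: remove from $F$ all clauses containing $\forall R.F_1$, and replace every literal $\exists R.F_2$ occurring in clauses of $F$ by $\exists R.(F_1\cup F_2)$. (A3) if all clauses of $F$ are unit clauses of the form $\{A\}$, $\{\lnot A\}$ or $\{\exists R.F'\}$: for some $\{\exists R.F_1\}\in F$, replace $F$ by $F\setminus\{\{\exists R.F_1\}\}$ and add $F_1$ to the family ($F$ is the parent of $F_1$ with respect to $R$). A family is complete if no rule is applicable to it. It is clash-free if no clause set in it contains the empty clause or contains both $\{L\}$ and $\{\overline{L}\}$ for some literal $L$. -}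

module Defs where

open import Data.Nat using (ℕ; _≟_)
open import Data.List using (List; []; _∷_; _++_; map; concatMap)
open import Data.List.Relation.Unary.Any using (Any)
open import Data.List.Relation.Unary.All using (All)
open import Data.List.Membership.Propositional using (_∈_)
open import Data.Product using (Σ; _×_)
open import Data.Sum using (_⊎_)
open import Data.Unit using (⊤)
open import Data.Empty using (⊥)
open import Data.Bool using (if_then_else_)
open import Relation.Nullary using (¬_)
open import Relation.Nullary.Decidable using (⌊_⌋)
open import Relation.Binary.PropositionalEquality using (_≡_)

-- A clause is a finite set of literals, a conjunctive normal form (clause
-- set) a finite set of clauses; finite sets are represented by lists and
-- compared up to the set-extensional equivalences _≈L_, _≈C_, _≈F_ below.

mutual
  data Lit : Set where
    pos  : ℕ → Lit
    neg  : ℕ → Lit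
    ex   : ℕ → List (List Lit) → Lit
    all  : ℕ → List (List Lit) → Lit

Clause : Set
Clause = List Lit

CNF : Set
CNF = List Clause

mutual
  data _≈L_ : Lit → Lit → Set where
    pos : ∀ a → pos a ≈L pos a
    neg : ∀ a → neg a ≈L neg a
    ex  : ∀ r {F G} → F ≈F G → ex r F ≈L ex r G
    all : ∀ r {F G} → F ≈F G → all r F ≈L all r G

  data _≈C_ (C D : Clause) : Set where
    set≈ : (∀ {L} → L ∈ C → Σ Lit (λ M → M ∈ D × L ≈L M)) →
           (∀ {M} → M ∈ D → Σ Lit (λ L → L ∈ C × L ≈L M)) →
           C ≈C D

  data _≈F_ (F G : CNF) : Set where
    set≈ : (∀ {C} → C ∈ F → Σ Clause (λ D → D ∈ G × C ≈C D)) →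
           (∀ {D} → D ∈ G → Σ Clause (λ C → C ∈ F × C ≈C D)) →
           F ≈F G

_∈L_ : Lit → Clause → Set
L ∈L C = Any (L ≈L_) C

UnitIn : Lit → CNF → Set
UnitIn L F = Any (_≈C (L ∷ [])) F

-- CNF(¬F) for a clause set F = {C₁,…,Cₖ} is
-- obtained by pushing negation inwards (¬Cᵢ = conjunction of the
-- complements of the literals of Cᵢ) and distributing ⊔ over ⊓:
-- its clauses are the choices {L̄₁,…,L̄ₖ} with Lᵢ ∈ Cᵢ.

choices : {A : Set} → List (List A) → List (List A)
choices []       = [] ∷ []
choices (C ∷ Cs) = concatMap (λ L → map (L ∷_) (choices Cs)) C

mutual
  compl : Lit → Lit
  compl (pos a)   = neg a
  compl (neg a)   = pos a
  compl (ex r F)  = all r (choices (complF F))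
  compl (all r F) = ex r (choices (complF F))

  complC : Clause → Clause
  complC []      = []
  complC (L ∷ C) = compl L ∷ complC C

  complF : CNF → CNF
  complF []      = []
  complF (C ∷ F) = complC C ∷ complF F

negCNF : CNF → CNF
negCNF F = choices (complF F)

record Interp : Set₁ where
  field
    Δ    : Set
    conc : ℕ → Δ → Set
    role : ℕ → Δ → Δ → Set

module _ (I : Interp) where
  open Interp I
  mutual
    ⟦_⟧L : Lit → Δ → Set
    ⟦ pos a ⟧L x   = conc a x
    ⟦ neg a ⟧L x   = ¬ conc a x
    ⟦ ex r F ⟧L x  = Σ Δ (λ y → role r x y × ⟦ F ⟧F y)
    ⟦ all r F ⟧L x = ∀ y → role r x y → ⟦ F ⟧F y

    ⟦_⟧C : Clause → Δ → Set
    ⟦ [] ⟧C x    = ⊥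
    ⟦ L ∷ C ⟧C x = ⟦ L ⟧L x ⊎ ⟦ C ⟧C x

    ⟦_⟧F : CNF → Δ → Set
    ⟦ [] ⟧F x    = ⊤
    ⟦ C ∷ F ⟧F x = ⟦ C ⟧C x × ⟦ F ⟧F x

Satisfiable : CNF → Set₁
Satisfiable F = Σ Interp (λ I → Σ (Interp.Δ I) (λ x → ⟦ I ⟧F F x))

-- F' is (up to ≈) the set { C' | C ∈ F, P C, R C C' } where R relates
-- each clause C to its (unique up to ≈) replacement.
record Image (F : CNF) (P : Clause → Set) (R : Clause → Clause → Set)
             (F' : CNF) : Set where
  field
    sound    : ∀ {C'} → C' ∈ F' → Σ Clause (λ C → C ∈ F × P C × R C C')
    complete : ∀ {C} → C ∈ F → P C → Σ Clause (λ C' → C' ∈ F' × R C C')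

Removed : Lit → Clause → Clause → Set
Removed M C C' =
  (∀ {K} → K ∈ C' → K ∈L C × ¬ K ≈L M) ×
  (∀ {K} → K ∈ C → ¬ K ≈L M → K ∈L C')

A1Clause : Lit → Clause → Clause → Set
A1Clause L C C' =
  (L ∈L C × C' ≈C (L ∷ [])) ⊎
  ((¬ L ∈L C) × compl L ∈L C × Removed (compl L) C C') ⊎
  ((¬ L ∈L C) × (¬ compl L ∈L C) × C' ≈C C)

IsUnit : Clause → Set
IsUnit C = Σ Lit (λ M → C ≈C (M ∷ []))

NotForall : Lit → Set
NotForall (all _ _) = ⊥
NotForall _         = ⊤

A3Form : Clause → Set
A3Form C = Σ Lit (λ M → C ≈C (M ∷ []) × NotForall M)

addForall : ℕ → CNF → Lit → Lit
addForall r F₁ (ex r' F₂) = if ⌊ r ≟ r' ⌋ then ex r' (F₁ ++ F₂) else ex r' F₂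
addForall r F₁ L          = L

data Rule (F : CNF) : CNF → List CNF → Set where
  A1⁺ : ∀ L {F'} →
        Any (L ∈L_) F →
        Image F (λ _ → ⊤) (A1Clause L) F' →
        Rule F F' []
  A2⁺ : ∀ r F₁ {F'} →
        All IsUnit F →
        Any (all r F₁ ∈L_) F →
        Image F (λ C → ¬ all r F₁ ∈L C)
                (λ C C' → C' ≈C map (addForall r F₁) C) F' →
        Rule F F' []
  A3  : ∀ r F₁ {F'} →
        All A3Form F →
        UnitIn (ex r F₁) F →
        Image F (λ C → ¬ C ≈C (ex r F₁ ∷ [])) _≈C_ F' →
        Rule F F' (F₁ ∷ [])

Family : Set
Family = List CNF

data Step : Family → Family → Set where
  step : ∀ pre F post {F' new} → Rule F F' new →
         Step (pre ++ F ∷ post) (pre ++ F' ∷ post ++ new)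

-- no rule is applicable: every rule application leaves the clause set
-- unchanged (up to ≈) and adds nothing
Complete : Family → Set
Complete S = ∀ {F F' new} → F ∈ S → Rule F F' new → F' ≈F F × new ≡ []

ClashFree : Family → Set
ClashFree S = ∀ {G} → G ∈ S →
  (¬ Any (_≈C []) G) × (∀ L → UnitIn L G → UnitIn (compl L) G → ⊥)

-- Satisfiability propagates backwards along a derivation, so it suffices to
-- treat the final family and single rule applications.
--
-- A complete clash-free clause set G is satisfiable in a one-point model
-- without role edges: completeness for A1⁺ makes every clause a unit, for
-- A2⁺ forbids ∀-literals and for A3 forbids ∃-literals, so G consists of
-- unit clauses {A} and {¬A}, which clash-freeness makes consistent.
--
-- Each rule reflects satisfiability.  A1⁺ only strengthens clauses.  For A2⁺
-- and A3 the model of the conclusion is hung below a fresh root x₀ copying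
-- the concepts of the satisfying point x: for A2⁺ the R-edges of x₀ lead only
-- to those R-successors of x satisfying F₁, which makes ∀R.F₁ true while the
-- literals ∃R.(F₁ ∪ F₂) still provide witnesses; for A3, x₀ gets an extra
-- R-edge to a model of the new clause set F₁.
module Submission where

open import Defs
open import Data.List using (List; []; _∷_; _++_; map; filter)
open import Data.List.Relation.Unary.Any using (Any; here; there; any?; fromSum; toSum)
open import Data.List.Relation.Unary.All as All using (All; []; _∷_)
open import Data.List.Relation.Unary.All.Properties using (++⁺; ++⁻)
open import Data.List.Membership.Propositional using (_∈_; find; lose)
open import Data.List.Membership.Propositional.Properties using (∈-map⁺; ∈-map⁻; ∈-filter⁺; ∈-filter⁻)
open import Data.Maybe using (Maybe; just; nothing)
open import Data.Nat using (ℕ; _≟_)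
open import Data.Product using (Σ; ∃; _×_; _,_; proj₁; proj₂; uncurry)
open import Data.Sum using (_⊎_; inj₁; inj₂)
open import Data.Unit using (⊤; tt)
open import Data.Empty using (⊥; ⊥-elim)
open import Function using (_∘_)
open import Relation.Binary.Construct.Closure.ReflexiveTransitive using (Star; ε; _◅_)
open import Relation.Binary.PropositionalEquality using (_≡_; refl; sym; subst)
open import Relation.Nullary using (¬_; Dec; yes; no)
open import Relation.Nullary.Decidable using (¬?; map′; _×-dec_; _⊎-dec_)
open import Relation.Unary using (Decidable)

mutual
  ≈L-refl : ∀ L → L ≈L L
  ≈L-refl (pos a)   = pos a
  ≈L-refl (neg a)   = neg a
  ≈L-refl (ex r F)  = ex r (≈F-refl F)
  ≈L-refl (all r F) = all r (≈F-refl F)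

  ≈L-refl* : (C : Clause) → All (λ L → L ≈L L) C
  ≈L-refl* []      = []
  ≈L-refl* (L ∷ C) = ≈L-refl L ∷ ≈L-refl* C

  ≈C-refl* : (F : CNF) → All (λ C → C ≈C C) F
  ≈C-refl* []      = []
  ≈C-refl* (C ∷ F) = ≈C-refl C ∷ ≈C-refl* F

  ≈C-refl : ∀ C → C ≈C C
  ≈C-refl C = set≈ (λ m → _ , m , All.lookup (≈L-refl* C) m) (λ m → _ , m , All.lookup (≈L-refl* C) m)

  ≈F-refl : ∀ F → F ≈F F
  ≈F-refl F = set≈ (λ m → _ , m , All.lookup (≈C-refl* F) m) (λ m → _ , m , All.lookup (≈C-refl* F) m)

mutual
  ≈L-sym : ∀ {L M} → L ≈L M → M ≈L L
  ≈L-sym (pos a)   = pos a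
  ≈L-sym (neg a)   = neg a
  ≈L-sym (ex r p)  = ex r (≈F-sym p)
  ≈L-sym (all r p) = all r (≈F-sym p)

  ≈C-sym : ∀ {C D} → C ≈C D → D ≈C C
  ≈C-sym {C} {D} (set≈ forth back) = set≈ forth′ back′
    where
    forth′ : ∀ {M} → M ∈ D → Σ Lit (λ L → L ∈ C × M ≈L L)
    forth′ m with back m
    ... | L , m′ , e = L , m′ , ≈L-sym e
    back′ : ∀ {L} → L ∈ C → Σ Lit (λ M → M ∈ D × M ≈L L)
    back′ m with forth m
    ... | M , m′ , e = M , m′ , ≈L-sym e

  ≈F-sym : ∀ {F G} → F ≈F G → G ≈F F
  ≈F-sym {F} {G} (set≈ forth back) = set≈ forth′ back′
    where
    forth′ : ∀ {D} → D ∈ G → Σ Clause (λ C → C ∈ F × D ≈C C)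
    forth′ m with back m
    ... | C , m′ , e = C , m′ , ≈C-sym e
    back′ : ∀ {C} → C ∈ F → Σ Clause (λ D → D ∈ G × D ≈C C)
    back′ m with forth m
    ... | D , m′ , e = D , m′ , ≈C-sym e

module _ {A : Set} {P : A → Set} where
  all-dec : ∀ {xs} → All (Dec ∘ P) xs → Dec (All P xs)
  all-dec []       = yes []
  all-dec (d ∷ ds) = map′ (uncurry _∷_) All.uncons (d ×-dec all-dec ds)

  any-dec : ∀ {xs} → All (Dec ∘ P) xs → Dec (Any P xs)
  any-dec []       = no λ ()
  any-dec (d ∷ ds) = map′ fromSum toSum (d ⊎-dec any-dec ds)

module _ {A : Set} {R : A → A → Set} where
  covered-forth? : ∀ {xs} ys → All (λ x → Decidable (R x)) xs →
                   Dec (∀ {x} → x ∈ xs → ∃ λ y → y ∈ ys × R x y)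
  covered-forth? ys ds =
    map′ (λ a m → find (All.lookup a m)) (λ h → All.tabulate (uncurry lose ∘ proj₂ ∘ h))
         (all-dec (All.map (λ d → any? d ys) ds))

  covered-back? : ∀ {xs} ys → All (λ x → Decidable (R x)) xs →
                  Dec (∀ {y} → y ∈ ys → ∃ λ x → x ∈ xs × R x y)
  covered-back? ys ds =
    map′ (λ a m → find (All.lookup a m)) (λ h → All.tabulate (uncurry lose ∘ proj₂ ∘ h))
         (All.all? (λ y → any-dec (All.map (λ d → d y) ds)) ys)

mutual
  _≈L?_ : (L M : Lit) → Dec (L ≈L M)
  pos a ≈L? pos b with a ≟ b
  ... | yes refl = yes (pos a)
  ... | no a≢b   = no λ { (pos _) → a≢b refl }
  neg a ≈L? neg b with a ≟ b
  ... | yes refl = yes (neg a)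
  ... | no a≢b   = no λ { (neg _) → a≢b refl }
  ex r F ≈L? ex s G with r ≟ s | F ≈F? G
  ... | yes refl | yes F≈G = yes (ex r F≈G)
  ... | yes refl | no F≉G  = no λ { (ex _ F≈G) → F≉G F≈G }
  ... | no r≢s   | _       = no λ { (ex _ _) → r≢s refl }
  all r F ≈L? all s G with r ≟ s | F ≈F? G
  ... | yes refl | yes F≈G = yes (all r F≈G)
  ... | yes refl | no F≉G  = no λ { (all _ F≈G) → F≉G F≈G }
  ... | no r≢s   | _       = no λ { (all _ _) → r≢s refl }
  pos _   ≈L? neg _   = no λ ()
  pos _   ≈L? ex _ _  = no λ ()
  pos _   ≈L? all _ _ = no λ ()
  neg _   ≈L? pos _   = no λ ()
  neg _   ≈L? ex _ _  = no λ ()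
  neg _   ≈L? all _ _ = no λ ()
  ex _ _  ≈L? pos _   = no λ ()
  ex _ _  ≈L? neg _   = no λ ()
  ex _ _  ≈L? all _ _ = no λ ()
  all _ _ ≈L? pos _   = no λ ()
  all _ _ ≈L? neg _   = no λ ()
  all _ _ ≈L? ex _ _  = no λ ()

  ≈L?* : (C : Clause) → All (λ L → Decidable (L ≈L_)) C
  ≈L?* []      = []
  ≈L?* (L ∷ C) = (L ≈L?_) ∷ ≈L?* C

  ≈C?* : (F : CNF) → All (λ C → Decidable (C ≈C_)) F
  ≈C?* []      = []
  ≈C?* (C ∷ F) = (C ≈C?_) ∷ ≈C?* F

  _≈C?_ : (C D : Clause) → Dec (C ≈C D)
  C ≈C? D = map′ (uncurry set≈) (λ { (set≈ f g) → f , g })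
                 (covered-forth? D (≈L?* C) ×-dec covered-back? D (≈L?* C))

  _≈F?_ : (F G : CNF) → Dec (F ≈F G)
  F ≈F? G = map′ (uncurry set≈) (λ { (set≈ f g) → f , g })
                 (covered-forth? G (≈C?* F) ×-dec covered-back? G (≈C?* F))

_∈L?_ : ∀ L C → Dec (L ∈L C)
L ∈L? C = any? (L ≈L?_) C

module _ (I : Interp) where
  open Interp I

  ⟦⟧C⁺ : ∀ {C L x} → L ∈ C → ⟦ I ⟧L L x → ⟦ I ⟧C C x
  ⟦⟧C⁺ (here refl) h = inj₁ h
  ⟦⟧C⁺ (there m)   h = inj₂ (⟦⟧C⁺ m h)

  ⟦⟧C⁻ : ∀ C {x} → ⟦ I ⟧C C x → ∃ λ L → L ∈ C × ⟦ I ⟧L L x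
  ⟦⟧C⁻ (L ∷ C) (inj₁ h) = L , here refl , h
  ⟦⟧C⁻ (L ∷ C) (inj₂ h) with ⟦⟧C⁻ C h
  ... | M , m , h′ = M , there m , h′

  ⟦⟧F⁺ : ∀ F {x} → (∀ {C} → C ∈ F → ⟦ I ⟧C C x) → ⟦ I ⟧F F x
  ⟦⟧F⁺ []      h = tt
  ⟦⟧F⁺ (C ∷ F) h = h (here refl) , ⟦⟧F⁺ F (h ∘ there)

  ⟦⟧F⁻ : ∀ {F C x} → C ∈ F → ⟦ I ⟧F F x → ⟦ I ⟧C C x
  ⟦⟧F⁻ (here refl) (h , _) = h
  ⟦⟧F⁻ (there m)   (_ , h) = ⟦⟧F⁻ m h

  ⟦⟧F-++⁻ : ∀ F G {x} → ⟦ I ⟧F (F ++ G) x → ⟦ I ⟧F F x × ⟦ I ⟧F G x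
  ⟦⟧F-++⁻ []      G h        = tt , h
  ⟦⟧F-++⁻ (C ∷ F) G (h , hs) with ⟦⟧F-++⁻ F G hs
  ... | hF , hG = (h , hF) , hG

  mutual
    ⟦⟧L-resp : ∀ {L M x} → L ≈L M → ⟦ I ⟧L L x → ⟦ I ⟧L M x
    ⟦⟧L-resp (pos a)   h            = h
    ⟦⟧L-resp (neg a)   h            = h
    ⟦⟧L-resp (ex r p)  (y , ρ , h)  = y , ρ , ⟦⟧F-resp p h
    ⟦⟧L-resp (all r p) h            = λ y ρ → ⟦⟧F-resp p (h y ρ)

    ⟦⟧C-resp : ∀ {C D x} → C ≈C D → ⟦ I ⟧C C x → ⟦ I ⟧C D x
    ⟦⟧C-resp {C} (set≈ forth _) h with ⟦⟧C⁻ C h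
    ... | L , m , hL with forth m
    ... | M , m′ , e = ⟦⟧C⁺ m′ (⟦⟧L-resp e hL)

    ⟦⟧F-resp : ∀ {F G x} → F ≈F G → ⟦ I ⟧F F x → ⟦ I ⟧F G x
    ⟦⟧F-resp {F} {G} {x} (set≈ _ back) h = ⟦⟧F⁺ G sat
      where
      sat : ∀ {D} → D ∈ G → ⟦ I ⟧C D x
      sat m with back m
      ... | C , m′ , e = ⟦⟧C-resp e (⟦⟧F⁻ m′ h)

  ⟦⟧C-⊆ : ∀ {C D x} → (∀ {K} → K ∈ C → K ∈L D) → ⟦ I ⟧C C x → ⟦ I ⟧C D x
  ⟦⟧C-⊆ {C} C⊆D h with ⟦⟧C⁻ C h
  ... | K , m , hK with find (C⊆D m)
  ... | M , m′ , e = ⟦⟧C⁺ m′ (⟦⟧L-resp e hK)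

-- Embeddings onto successor-closed parts of an interpretation

record Embedding (I K : Interp) : Set where
  private
    module I = Interp I
    module K = Interp K
  field
    embed     : I.Δ → K.Δ
    conc⁺     : ∀ {a d} → I.conc a d → K.conc a (embed d)
    conc⁻     : ∀ {a d} → K.conc a (embed d) → I.conc a d
    role⁺     : ∀ {r d d′} → I.role r d d′ → K.role r (embed d) (embed d′)
    role⁻     : ∀ {r d y} → K.role r (embed d) y → ∃ λ d′ → y ≡ embed d′ × I.role r d d′

module _ {I K : Interp} (e : Embedding I K) where
  open Embedding e

  mutual
    ⟦⟧L-embed : ∀ L {d} → ⟦ I ⟧L L d → ⟦ K ⟧L L (embed d)
    ⟦⟧L-embed (pos a)   h           = conc⁺ h
    ⟦⟧L-embed (neg a)   h           = h ∘ conc⁻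
    ⟦⟧L-embed (ex r F)  (y , ρ , h) = embed y , role⁺ ρ , ⟦⟧F-embed F h
    ⟦⟧L-embed (all r F) h y ρ with role⁻ ρ
    ... | d′ , refl , ρ′ = ⟦⟧F-embed F (h d′ ρ′)

    ⟦⟧C-embed : ∀ C {d} → ⟦ I ⟧C C d → ⟦ K ⟧C C (embed d)
    ⟦⟧C-embed (L ∷ C) (inj₁ h) = inj₁ (⟦⟧L-embed L h)
    ⟦⟧C-embed (L ∷ C) (inj₂ h) = inj₂ (⟦⟧C-embed C h)

    ⟦⟧F-embed : ∀ F {d} → ⟦ I ⟧F F d → ⟦ K ⟧F F (embed d)
    ⟦⟧F-embed []      h        = tt
    ⟦⟧F-embed (C ∷ F) (h , hs) = ⟦⟧C-embed C h , ⟦⟧F-embed F hs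

_⊕_ : Interp → Interp → Interp
I ⊕ J = record { Δ = I.Δ ⊎ J.Δ ; conc = conc ; role = role }
  where
  module I = Interp I
  module J = Interp J
  conc : ℕ → I.Δ ⊎ J.Δ → Set
  conc a (inj₁ d) = I.conc a d
  conc a (inj₂ d) = J.conc a d
  role : ℕ → I.Δ ⊎ J.Δ → I.Δ ⊎ J.Δ → Set
  role r (inj₁ d) (inj₁ d′) = I.role r d d′
  role r (inj₂ d) (inj₂ d′) = J.role r d d′
  role r _        _         = ⊥

inj₁-embedding : ∀ I J → Embedding I (I ⊕ J)
inj₁-embedding I J = record
  { embed = inj₁ ; conc⁺ = λ h → h ; conc⁻ = λ h → h ; role⁺ = λ h → h ; role⁻ = back }
  where
  back : ∀ {r d y} → Interp.role (I ⊕ J) r (inj₁ d) y →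
         ∃ λ d′ → y ≡ inj₁ d′ × Interp.role I r d d′
  back {y = inj₁ d′} ρ = d′ , refl , ρ

inj₂-embedding : ∀ I J → Embedding J (I ⊕ J)
inj₂-embedding I J = record
  { embed = inj₂ ; conc⁺ = λ h → h ; conc⁻ = λ h → h ; role⁺ = λ h → h ; role⁻ = back }
  where
  back : ∀ {r d y} → Interp.role (I ⊕ J) r (inj₂ d) y →
         ∃ λ d′ → y ≡ inj₂ d′ × Interp.role J r d d′
  back {y = inj₂ d′} ρ = d′ , refl , ρ

-- The fresh root is nothing, with concepts c and role edges ρ.
addRoot : (K : Interp) → (ℕ → Set) → (ℕ → Interp.Δ K → Set) → Interp
addRoot K c ρ = record { Δ = Maybe K.Δ ; conc = conc ; role = role }
  where
  module K = Interp K
  conc : ℕ → Maybe K.Δ → Set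
  conc a nothing  = c a
  conc a (just d) = K.conc a d
  role : ℕ → Maybe K.Δ → Maybe K.Δ → Set
  role r nothing  (just d′) = ρ r d′
  role r (just d) (just d′) = K.role r d d′
  role r _        nothing   = ⊥

just-embedding : ∀ K c ρ → Embedding K (addRoot K c ρ)
just-embedding K c ρ = record
  { embed = just ; conc⁺ = λ h → h ; conc⁻ = λ h → h ; role⁺ = λ h → h ; role⁻ = back }
  where
  back : ∀ {r d y} → Interp.role (addRoot K c ρ) r (just d) y →
         ∃ λ d′ → y ≡ just d′ × Interp.role K r d d′
  back {y = just d′} ρ′ = d′ , refl , ρ′

-- Every rule reflects satisfiability

A1Clause-weakens : ∀ I {L C C′ x} → A1Clause L C C′ → ⟦ I ⟧C C′ x → ⟦ I ⟧C C x
A1Clause-weakens I (inj₁ (L∈C , C′≈L)) h =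
  ⟦⟧C-⊆ I (λ { (here refl) → L∈C }) (⟦⟧C-resp I C′≈L h)
A1Clause-weakens I (inj₂ (inj₁ (_ , _ , C′⊆C , _))) h = ⟦⟧C-⊆ I (proj₁ ∘ C′⊆C) h
A1Clause-weakens I (inj₂ (inj₂ (_ , _ , C′≈C))) h = ⟦⟧C-resp I C′≈C h

A1⁺-reflects-sat : ∀ {L F F′} → Image F (λ _ → ⊤) (A1Clause L) F′ →
                   Satisfiable F′ → Satisfiable F
A1⁺-reflects-sat {F = F} im (I , x , h) = I , x , ⟦⟧F⁺ I F sat
  where
  sat : ∀ {C} → C ∈ F → ⟦ I ⟧C C x
  sat m with Image.complete im m tt
  ... | C′ , m′ , a = A1Clause-weakens I a (⟦⟧F⁻ I m′ h)

A2⁺-reflects-sat : ∀ {r F₁ F F′} →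
                   Image F (λ C → ¬ all r F₁ ∈L C) (λ C C′ → C′ ≈C map (addForall r F₁) C) F′ →
                   Satisfiable F′ → Satisfiable F
A2⁺-reflects-sat {r} {F₁} {F} im (I , x , h) = K , nothing , ⟦⟧F⁺ K F sat
  where
  open Interp I
  edge : ℕ → Δ → Set
  edge s y = role s x y × (s ≡ r → ⟦ I ⟧F F₁ y)
  K : Interp
  K = addRoot I (λ a → conc a x) edge
  ⟦⟧F-just : ∀ G {d} → ⟦ I ⟧F G d → ⟦ K ⟧F G (just d)
  ⟦⟧F-just = ⟦⟧F-embed (just-embedding I (λ a → conc a x) edge)

  root-∀ : ⟦ K ⟧L (all r F₁) nothing
  root-∀ (just y) (_ , F₁y) = ⟦⟧F-just F₁ (F₁y refl)

  root-lit : ∀ L → ⟦ I ⟧L (addForall r F₁ L) x → ⟦ K ⟧L L nothing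
  root-lit (pos a) hL = hL
  root-lit (neg a) hL = hL
  root-lit (ex s F₂) hL with r ≟ s | hL
  ... | yes refl | y , ρ , F₁F₂y with ⟦⟧F-++⁻ I F₁ F₂ F₁F₂y
  ...   | F₁y , F₂y = just y , (ρ , λ _ → F₁y) , ⟦⟧F-just F₂ F₂y
  root-lit (ex s F₂) hL | no r≢s | y , ρ , F₂y =
    just y , (ρ , λ { refl → ⊥-elim (r≢s refl) }) , ⟦⟧F-just F₂ F₂y
  root-lit (all s G) hL (just y) (ρ , _) = ⟦⟧F-just G (hL y ρ)

  root-clause : ∀ C → ⟦ I ⟧C (map (addForall r F₁) C) x → ⟦ K ⟧C C nothing
  root-clause (L ∷ C) (inj₁ hL) = inj₁ (root-lit L hL)
  root-clause (L ∷ C) (inj₂ hC) = inj₂ (root-clause C hC)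

  sat : ∀ {C} → C ∈ F → ⟦ K ⟧C C nothing
  sat {C} m with all r F₁ ∈L? C
  ... | yes ∀∈C with find ∀∈C
  ...   | M , M∈C , ∀≈M = ⟦⟧C⁺ K M∈C (⟦⟧L-resp K ∀≈M root-∀)
  sat {C} m | no ∀∉C with Image.complete im m ∀∉C
  ... | C′ , m′ , C′≈ = root-clause C (⟦⟧C-resp I C′≈ (⟦⟧F⁻ I m′ h))

A3-reflects-sat : ∀ {r F₁ F F′} → All A3Form F →
                  Image F (λ C → ¬ C ≈C (ex r F₁ ∷ [])) _≈C_ F′ →
                  Satisfiable F′ → Satisfiable F₁ → Satisfiable F
A3-reflects-sat {r} {F₁} {F} forms im (I , x , h) (J , y , k) = K , nothing , ⟦⟧F⁺ K F sat
  where
  open Interp I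
  edge : ℕ → Δ ⊎ Interp.Δ J → Set
  edge s (inj₁ d) = role s x d
  edge s (inj₂ d) = s ≡ r × d ≡ y
  K : Interp
  K = addRoot (I ⊕ J) (λ a → conc a x) edge
  ⟦⟧F-just : ∀ G {d} → ⟦ I ⊕ J ⟧F G d → ⟦ K ⟧F G (just d)
  ⟦⟧F-just = ⟦⟧F-embed (just-embedding (I ⊕ J) (λ a → conc a x) edge)

  root-lit : ∀ M → NotForall M → ⟦ I ⟧L M x → ⟦ K ⟧L M nothing
  root-lit (pos a)   _ hM          = hM
  root-lit (neg a)   _ hM          = hM
  root-lit (ex s G)  _ (d , ρ , g) = just (inj₁ d) , ρ , ⟦⟧F-just G (⟦⟧F-embed (inj₁-embedding I J) G g)
  root-lit (all s G) ()

  sat : ∀ {C} → C ∈ F → ⟦ K ⟧C C nothing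
  sat {C} m with C ≈C? (ex r F₁ ∷ [])
  ... | yes C≈∃ = ⟦⟧C-resp K (≈C-sym C≈∃)
                    (inj₁ (just (inj₂ y) , (refl , refl) , ⟦⟧F-just F₁ (⟦⟧F-embed (inj₂-embedding I J) F₁ k)))
  ... | no C≉∃ with Image.complete im m C≉∃ | All.lookup forms m
  ...   | C′ , m′ , C≈C′ | M , C≈M , M≢∀ with ⟦⟧C-resp I C≈M (⟦⟧C-resp I (≈C-sym C≈C′) (⟦⟧F⁻ I m′ h))
  ...     | inj₁ hM = ⟦⟧C-resp K (≈C-sym C≈M) (inj₁ (root-lit M M≢∀ hM))

Rule-reflects-sat : ∀ {F F′ new} → Rule F F′ new → Satisfiable F′ → All Satisfiable new → Satisfiable F
Rule-reflects-sat (A1⁺ L _ im)         sat _           = A1⁺-reflects-sat im sat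
Rule-reflects-sat (A2⁺ r F₁ _ _ im)    sat _           = A2⁺-reflects-sat im sat
Rule-reflects-sat (A3 r F₁ forms _ im) sat (sat₁ ∷ []) = A3-reflects-sat forms im sat sat₁

Step-reflects-sat : ∀ {S S′} → Step S S′ → All Satisfiable S′ → All Satisfiable S
Step-reflects-sat (step pre F post rule) sat with ++⁻ pre sat
... | satPre , satF′ ∷ satRest with ++⁻ post satRest
...   | satPost , satNew = ++⁺ satPre (Rule-reflects-sat rule satF′ satNew ∷ satPost)

Star-reflects-sat : ∀ {S S′} → Star Step S S′ → All Satisfiable S′ → All Satisfiable S
Star-reflects-sat ε          sat = sat
Star-reflects-sat (st ◅ sts) sat = Step-reflects-sat st (Star-reflects-sat sts sat)

-- Complete clash-free clause sets are satisfiable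

a1-clause : Lit → Clause → Clause
a1-clause L D with L ∈L? D | compl L ∈L? D
... | yes _ | _     = L ∷ []
... | no _  | yes _ = filter (λ K → ¬? (K ≈L? compl L)) D
... | no _  | no _  = D

A1Clause-a1-clause : ∀ L D → A1Clause L D (a1-clause L D)
A1Clause-a1-clause L D with L ∈L? D | compl L ∈L? D
... | yes L∈D | _        = inj₁ (L∈D , ≈C-refl _)
... | no L∉D  | yes L̄∈D = inj₂ (inj₁ (L∉D , L̄∈D , removed , kept))
  where
  P? : Decidable (λ K → ¬ K ≈L compl L)
  P? = λ K → ¬? (K ≈L? compl L)
  removed : ∀ {K} → K ∈ filter P? D → K ∈L D × ¬ K ≈L compl L
  removed k with ∈-filter⁻ P? k
  ... | k∈D , K≉L̄ = lose k∈D (≈L-refl _) , K≉L̄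
  kept : ∀ {K} → K ∈ D → ¬ K ≈L compl L → K ∈L filter P? D
  kept k K≉L̄ = lose (∈-filter⁺ P? k K≉L̄) (≈L-refl _)
... | no L∉D  | no L̄∉D  = inj₂ (inj₂ (L∉D , L̄∉D , ≈C-refl _))

a1-clause-shape : ∀ L D → a1-clause L D ≡ L ∷ [] ⊎ (¬ L ∈L D × (∀ {N} → N ∈ a1-clause L D → N ∈ D))
a1-clause-shape L D with L ∈L? D | compl L ∈L? D
... | yes _   | _     = inj₁ refl
... | no L∉D  | yes _ = inj₂ (L∉D , proj₁ ∘ ∈-filter⁻ (λ K → ¬? (K ≈L? compl L)))
... | no L∉D  | no _  = inj₂ (L∉D , λ n → n)

A1⁺-image : ∀ L G → Image G (λ _ → ⊤) (A1Clause L) (map (a1-clause L) G)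
A1⁺-image L G = record
  { sound    = λ m → let C , C∈G , eq = ∈-map⁻ (a1-clause L) m
                     in C , C∈G , tt , subst (A1Clause L C) (sym eq) (A1Clause-a1-clause L C)
  ; complete = λ m _ → _ , ∈-map⁺ (a1-clause L) m , A1Clause-a1-clause L _ }

A2⁺-image : ∀ r F₁ G → Image G (λ C → ¬ all r F₁ ∈L C) (λ C C′ → C′ ≈C map (addForall r F₁) C)
                               (map (map (addForall r F₁)) (filter (λ C → ¬? (all r F₁ ∈L? C)) G))
A2⁺-image r F₁ G = record
  { sound    = λ m → let C , C∈ , eq = ∈-map⁻ (map (addForall r F₁)) m
                         C∈G , ∀∉C = ∈-filter⁻ P? C∈
                     in C , C∈G , ∀∉C , subst (_≈C map (addForall r F₁) C) (sym eq) (≈C-refl _)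
  ; complete = λ m ∀∉C → _ , ∈-map⁺ (map (addForall r F₁)) (∈-filter⁺ P? m ∀∉C) , ≈C-refl _ }
  where
  P? : Decidable (λ C → ¬ all r F₁ ∈L C)
  P? = λ C → ¬? (all r F₁ ∈L? C)

A3-image : ∀ r F₁ G → Image G (λ C → ¬ C ≈C (ex r F₁ ∷ [])) _≈C_ (filter (λ C → ¬? (C ≈C? (ex r F₁ ∷ []))) G)
A3-image r F₁ G = record
  { sound    = λ {C} m → let C∈G , C≉∃ = ∈-filter⁻ P? m in C , C∈G , C≉∃ , ≈C-refl C
  ; complete = λ m C≉∃ → _ , ∈-filter⁺ P? m C≉∃ , ≈C-refl _ }
  where
  P? : Decidable (λ C → ¬ C ≈C (ex r F₁ ∷ []))
  P? = λ C → ¬? (C ≈C? (ex r F₁ ∷ []))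

addForall-∀ : ∀ r F₁ P {s G} → addForall r F₁ P ≈L all s G → P ≈L all s G
addForall-∀ r F₁ (pos a)   e = e
addForall-∀ r F₁ (neg a)   e = e
addForall-∀ r F₁ (ex s F₂) e with r ≟ s | e
... | yes _ | ()
... | no _  | ()
addForall-∀ r F₁ (all s F₂) e = e

module _ {G : CNF} (stable : ∀ {G′ new} → Rule G G′ new → G′ ≈F G × new ≡ []) where

  head-unit : ∀ {L C} → (L ∷ C) ∈ G → (L ∷ C) ≈C (L ∷ [])
  head-unit {L} {C} m with proj₁ (stable (A1⁺ L (lose m (here (≈L-refl L))) (A1⁺-image L G)))
  ... | set≈ _ back with back m
  ... | D′ , D′∈ , D′≈ with ∈-map⁻ (a1-clause L) D′∈
  ... | D , D∈G , refl with a1-clause-shape L D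
  ... | inj₁ eq = ≈C-sym (subst (_≈C (L ∷ C)) eq D′≈)
  ... | inj₂ (L∉D , D′⊆D) with D′≈
  ... | set≈ _ back′ with back′ (here refl)
  ... | N , N∈D′ , N≈L = ⊥-elim (L∉D (lose (D′⊆D N∈D′) (≈L-sym N≈L)))

  module _ (nonEmpty : ¬ Any (_≈C []) G) where

    all-unit : All IsUnit G
    all-unit = All.tabulate unit
      where
      unit : ∀ {D} → D ∈ G → IsUnit D
      unit {[]}    m = ⊥-elim (nonEmpty (lose m (≈C-refl [])))
      unit {L ∷ C} m = L , head-unit m

    no-∀ : ∀ {r F₁ C} → (all r F₁ ∷ C) ∈ G → ⊥
    no-∀ {r} {F₁} m with proj₁ (stable (A2⁺ r F₁ all-unit (lose m (here (≈L-refl _))) (A2⁺-image r F₁ G)))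
    ... | set≈ _ back with back m
    ... | D′ , D′∈ , set≈ _ back′ with ∈-map⁻ (map (addForall r F₁)) D′∈
    ... | D , D∈ , refl with ∈-filter⁻ (λ C → ¬? (all r F₁ ∈L? C)) {xs = G} D∈ | back′ (here refl)
    ... | _ , ∀∉D | N , N∈D′ , N≈∀ with ∈-map⁻ (addForall r F₁) N∈D′
    ... | P , P∈D , refl = ∀∉D (lose P∈D (≈L-sym (addForall-∀ r F₁ P N≈∀)))

    all-A3Form : All A3Form G
    all-A3Form = All.tabulate form
      where
      form : ∀ {D} → D ∈ G → A3Form D
      form {[]}          m = ⊥-elim (nonEmpty (lose m (≈C-refl [])))
      form {pos a ∷ C}   m = pos a , head-unit m , tt
      form {neg a ∷ C}   m = neg a , head-unit m , tt
      form {ex r F ∷ C}  m = ex r F , head-unit m , tt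
      form {all r F ∷ C} m = ⊥-elim (no-∀ m)

    no-∃ : ∀ {r F₁ C} → (ex r F₁ ∷ C) ∈ G → ⊥
    no-∃ {r} {F₁} m with proj₂ (stable (A3 r F₁ all-A3Form (lose m (head-unit m)) (A3-image r F₁ G)))
    ... | ()

    stable⇒sat : (∀ L → UnitIn L G → UnitIn (compl L) G → ⊥) → Satisfiable G
    stable⇒sat clash = M , tt , ⟦⟧F⁺ M G sat
      where
      M : Interp
      M = record { Δ = ⊤ ; conc = λ a _ → ¬ UnitIn (neg a) G ; role = λ _ _ _ → ⊥ }
      sat : ∀ {C} → C ∈ G → ⟦ M ⟧C C tt
      sat {[]}          m = ⊥-elim (nonEmpty (lose m (≈C-refl [])))
      sat {pos a ∷ C}   m = inj₁ (clash (pos a) (lose m (head-unit m)))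
      sat {neg a ∷ C}   m = inj₁ (λ ¬neg → ¬neg (lose m (head-unit m)))
      sat {ex r F ∷ C}  m = ⊥-elim (no-∃ m)
      sat {all r F ∷ C} m = ⊥-elim (no-∀ m)

mainTheorem6 : (F : CNF) (Sₙ : Family) →
    Star Step (F ∷ []) Sₙ → Complete Sₙ → ClashFree Sₙ → Satisfiable F
mainTheorem6 F Sₙ derivation complete clashFree =
  All.head (Star-reflects-sat derivation (All.tabulate λ m →
    stable⇒sat (complete m) (proj₁ (clashFree m)) (proj₂ (clashFree m))))
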